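{- Let $S$ be a decision rule system. Then: (a) $h_{EAR}(S)\ge h_{AR}(S)\ge d(S)$. (b) If $S$ is SR-reduced, then $h_{ESR}(S)\ge d(S)$. (c) If $S$ is AD-reduced, then $h_{EAD}(S)\ge d(S)$.
   Context: Let $\omega=\{0,1,2,\dots\}$ and let $\{a_i:i\in\omega\}$ be a set of attributes. A decision rule $r$ is an expression $(a_{i_1}=\delta_1)\wedge\cdots\wedge(a_{i_m}=\delta_m)\to\sigma$ with $m\in\omega$, pairwise different attributes, and $\delta_j,\sigma\in\omega$. Its length is $m$, its right-hand side is $\sigma$, $A(r)=\{a_{i_1},\dots,a_{i_m}\}$, and $K(r)=\{a_{i_1}=\delta_1,\dots,a_{i_m}=\delta_m\}$. Two rules are equal iff they have the same $K(\cdot)$ and the same right-hand side. A decision rule system $S$ is a finite nonempty set of decision rules. Let $A(S)=\bigcup_{r\in S}A(r)$, $n(S)=|A(S)|$, $d(S)$ = maximum length of a rule of $S$, and let $D(Z)$ be the set of right-hand sides of rules in $Z\subseteq S$. For $a_i\in A(S)$, $V_S(a_i)=\{\delta:(a_i=\delta)\in\bigcup_{r\in S}K(r)\}$ and $EV_S(a_i)=V_S(a_i)\cup\{*\}$, where $*$ is a symbol not in $\omega$. A set of equations $\{a_{i_1}=\delta_1,\dots,a_{i_m}=\delta_m\}$ with $\delta_j\in\omega\cup\{*\}$ is inconsistent if there are $l\ne t$ with $i_l=i_t$ and $\delta_l\ne\delta_t$, and consistent otherwise. $S$ is SR-reduced if there are no $r,r'\in S$ with $K(r')\subsetneq K(r)$.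 $S$ is AD-reduced if there are no $r,r'\in S$ with the same right-hand side and $K(r')\subsetneq K(r)$. A decision tree over $S$ is a finite directed rooted tree with working nodes labeled by attributes from $A(S)$ and terminal nodes labeled by subsets of $S$. In an o-tree, a working node labeled $a_i$ has exactly $|V_S(a_i)|$ outgoing edges, labeled with pairwise distinct elements of $V_S(a_i)$. In an e-tree, it has exactly $|EV_S(a_i)|$ outgoing edges, labeled with pairwise distinct elements of $EV_S(a_i)$. For a complete path $\xi$ (root to terminal node), $K(\xi)$ is the set of equations $a_i=\delta$ with $a_i$ labeling a working node of $\xi$ and $\delta$ labeling the edge of $\xi$ leaving it. $\tau(\xi)$ is the label of the terminal node of $\xi$, and $h(\xi)$ is the number of working nodes of $\xi$. The depth $h(\Gamma)$ is the maximum of $h(\xi)$ over complete paths. An o-tree (resp. e-tree) solves $AR(S)$ (resp. $EAR(S)$) if every complete path $\xi$ with $K(\xi)$ consistent satisfies: $K(r)\subseteq K(\xi)$ for all $r\in\tau(\xi)$, and $K(r)\cup K(\xi)$ is inconsistent for all $r\in S\setminus\tau(\xi)$. It solves $AD(S)$ (resp. $EAD(S)$) if every such $\xi$ satisfies: $K(r)\subseteq K(\xi)$ for $r\in\tau(\xi)$, and $K(r)\cup K(\xi)$ is inconsistent for each $r\in S\setminus\tau(\xi)$ whose right-hand side is not in $D(\tau(\xi))$. It solves $SR(S)$ (resp. $ESR(S)$) if every such $\xi$ satisfies: $K(r)\subseteq K(\xi)$ for $r\in\tau(\xi)$, and if $\tau(\xi)=\emptyset$ then $K(r)\cup K(\xi)$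 is inconsistent for all $r\in S$. For $C\in\{AR,EAR,AD,EAD,SR,ESR\}$, $h_C(S)$ is the minimum depth of a decision tree over $S$ solving $C(S)$. If $n(S)=0$, this is $0$. -}

module Defs where

open import Data.Nat using (ℕ; zero; suc; _⊔_; _≤_)
open import Data.Maybe using (Maybe; just; nothing)
open import Data.Product using (Σ; ∃; _×_; _,_; proj₁; proj₂)
open import Data.Sum using (_⊎_)
open import Data.List using (List; []; _∷_; map; length; _++_)
open import Data.List.Membership.Propositional using (_∈_; _∉_)
open import Data.List.Relation.Unary.Any using (Any)
open import Data.List.Relation.Unary.All using (All)
open import Data.List.Relation.Unary.Unique.Propositional using (Unique)
open import Relation.Binary.PropositionalEquality using (_≡_)
open import Relation.Nullary using (¬_)
open import Function.Bundles using (_⇔_)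

-- Attributes a_i are identified with their index i : ℕ, values are ℕ.
-- Extended values EV = Maybe ℕ, where nothing plays the role of *.

Eq : Set
Eq = ℕ × Maybe ℕ

record Rule : Set where
  constructor mkRule
  field
    conds    : List (ℕ × ℕ)
    distinct : Unique (map proj₁ conds)
    rhs      : ℕ
open Rule public

K : Rule → List Eq
K r = map (λ c → proj₁ c , just (proj₂ c)) (conds r)

len : Rule → ℕ
len r = length (conds r)

_≈R_ : Rule → Rule → Set
r ≈R r' = (∀ e → (e ∈ conds r) ⇔ (e ∈ conds r')) × (rhs r ≡ rhs r')

_∈R_ : Rule → List Rule → Set
r ∈R τ = Any (r ≈R_) τ

_∉R_ : Rule → List Rule → Set
r ∉R τ = ¬ (r ∈R τ)

_⊆E_ : List Eq → List Eq → Set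
E ⊆E F = ∀ {e} → e ∈ E → e ∈ F

_⊂K_ : Rule → Rule → Set
r' ⊂K r = (K r' ⊆E K r) × ¬ (K r ⊆E K r')

Consistent : List Eq → Set
Consistent E = ∀ {i δ δ'} → (i , δ) ∈ E → (i , δ') ∈ E → δ ≡ δ'

Inconsistent : List Eq → Set
Inconsistent E = ¬ Consistent E

-- Decision rule systems are represented by a list of rules (finite set;
-- nonemptiness is an explicit hypothesis).

d : List Rule → ℕ
d []      = 0
d (r ∷ S) = len r ⊔ d S

InV : List Rule → ℕ → ℕ → Set
InV S a δ = Σ Rule λ r → r ∈ S × (a , δ) ∈ conds r

InA : List Rule → ℕ → Set
InA S a = ∃ λ δ → InV S a δ

D : List Rule → List ℕ
D Z = map rhs Z

OLabel : List Rule → ℕ → Maybe ℕ → Set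
OLabel S a v = ∃ λ δ → (v ≡ just δ) × InV S a δ

ELabel : List Rule → ℕ → Maybe ℕ → Set
ELabel S a v = (v ≡ nothing) ⊎ OLabel S a v

data Tree : Set where
  leaf : List Rule → Tree
  node : ℕ → List (Maybe ℕ × Tree) → Tree

data WF (S : List Rule) (L : ℕ → Maybe ℕ → Set) : Tree → Set where
  leaf : ∀ τ → (∀ {r} → r ∈ τ → r ∈R S) → WF S L (leaf τ)
  node : ∀ a cs → InA S a
       → Unique (map proj₁ cs)
       → (∀ v → (v ∈ map proj₁ cs) ⇔ L a v)
       → All (λ c → WF S L (proj₂ c)) cs
       → WF S L (node a cs)

OTree : List Rule → Tree → Set
OTree S = WF S (OLabel S)

ETree : List Rule → Tree → Set
ETree S = WF S (ELabel S)

-- Complete paths: Path Γ Kξ τ h  means there is a complete path ξ in Γ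
-- with K(ξ) = Kξ, τ(ξ) = τ and h(ξ) = h.
data Path : Tree → List Eq → List Rule → ℕ → Set where
  leaf : ∀ τ → Path (leaf τ) [] τ 0
  node : ∀ {a cs v t Kξ τ h} → (v , t) ∈ cs → Path t Kξ τ h
       → Path (node a cs) ((a , v) ∷ Kξ) τ (suc h)

mutual
  depth : Tree → ℕ
  depth (leaf _)    = 0
  depth (node _ cs) = suc (depths cs)

  depths : List (Maybe ℕ × Tree) → ℕ
  depths []             = 0
  depths ((_ , t) ∷ cs) = depth t ⊔ depths cs

SolvesAR : List Rule → Tree → Set
SolvesAR S Γ = ∀ {Kξ τ h} → Path Γ Kξ τ h → Consistent Kξ
  → (∀ {r} → r ∈ τ → K r ⊆E Kξ)
  × (∀ {r} → r ∈ S → r ∉R τ → Inconsistent (K r ++ Kξ))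

SolvesAD : List Rule → Tree → Set
SolvesAD S Γ = ∀ {Kξ τ h} → Path Γ Kξ τ h → Consistent Kξ
  → (∀ {r} → r ∈ τ → K r ⊆E Kξ)
  × (∀ {r} → r ∈ S → r ∉R τ → rhs r ∉ D τ → Inconsistent (K r ++ Kξ))

SolvesSR : List Rule → Tree → Set
SolvesSR S Γ = ∀ {Kξ τ h} → Path Γ Kξ τ h → Consistent Kξ
  → (∀ {r} → r ∈ τ → K r ⊆E Kξ)
  × (τ ≡ [] → ∀ {r} → r ∈ S → Inconsistent (K r ++ Kξ))

SRReduced : List Rule → Set
SRReduced S = ∀ {r r'} → r ∈ S → r' ∈ S → ¬ (r' ⊂K r)

ADReduced : List Rule → Set
ADReduced S = ∀ {r r'} → r ∈ S → r' ∈ S → rhs r ≡ rhs r' → ¬ (r' ⊂K r)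

{-# OPTIONS --safe #-}
module Submission where

-- For r ∈ S follow the path ξ of the tree along r's own values, using * (e-trees) or arbitrary
-- values of V_S (o-trees) on the other attributes. K(ξ) is consistent with K(r), so a tree
-- solving AR must accept r on ξ; for SR and AD it accepts some rule contained in r, which by
-- reducedness also contains r. Either way K(r) ⊆ K(ξ), and the attributes of r being distinct,
-- len r ≤ h(ξ) ≤ depth. Deleting the * edges of an e-tree keeps it solving AR, since every
-- path of the result is a path of the original.

open import Defs
open import Data.Nat using (ℕ; suc; _≤_; _≤?_; _≟_; z≤n; s≤s)
open import Data.Nat.Properties using (≤-trans; ≤-reflexive; ⊔-lub; ⊔-mono-≤; m≤m⊔n; m≤n⇒m≤o⊔n; module ≤-Reasoning)
open import Data.Maybe using (Maybe; just; nothing; _<∣>_)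
open import Data.Product using (Σ; ∃; _×_; _,_; proj₁; proj₂)
open import Data.Sum using (inj₁; inj₂)
open import Data.List using (List; []; _∷_; map; length; _++_)
open import Data.List.Properties using (length-map; length-++-sucʳ)
open import Data.List.Membership.Propositional using (_∈_; find)
open import Data.List.Membership.Propositional.Properties using (∈-map⁺; ∈-map⁻; ∈-++⁺ˡ; ∈-++⁺ʳ; ∈-++⁻; ∈-∃++)
open import Data.List.Relation.Binary.Subset.Propositional using (_⊆_)
open import Data.List.Relation.Unary.Any using (here; there)
open import Data.List.Relation.Unary.All as All using (All; []; _∷_)
open import Data.List.Relation.Unary.AllPairs using ([]; _∷_)
open import Data.List.Relation.Unary.Unique.Propositional using (Unique)
import Data.List.Relation.Unary.Unique.Propositional.Properties as Unique
open import Function using (_∘_)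
open import Function.Bundles using (mk⇔; Equivalence)
open import Relation.Binary.PropositionalEquality using (_≡_; _≢_; refl; sym; trans; cong; subst)
open import Relation.Nullary using (¬_; yes; no; contradiction)
open import Relation.Nullary.Decidable using (decidable-stable)

unique⊆⇒length≤ : {A : Set} {xs ys : List A} → Unique xs → xs ⊆ ys → length xs ≤ length ys
unique⊆⇒length≤ {xs = []} _ _ = z≤n
unique⊆⇒length≤ {xs = x ∷ xs} (x∉xs ∷ u) xs⊆ys
  with as , bs , refl ← ∈-∃++ (xs⊆ys (here refl)) =
  ≤-trans (s≤s (unique⊆⇒length≤ u xs⊆as++bs)) (≤-reflexive (sym (length-++-sucʳ as x bs)))
  where
  xs⊆as++bs : xs ⊆ as ++ bs
  xs⊆as++bs y∈xs with ∈-++⁻ as (xs⊆ys (there y∈xs))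
  ... | inj₁ y∈as          = ∈-++⁺ˡ y∈as
  ... | inj₂ (here refl)   = contradiction refl (All.lookup x∉xs y∈xs)
  ... | inj₂ (there y∈bs)  = ∈-++⁺ʳ as y∈bs

Assignment : Set
Assignment = ℕ → Maybe ℕ

_⊨_ : Assignment → List Eq → Set
f ⊨ E = ∀ {a v} → (a , v) ∈ E → f a ≡ v

⊨⇒consistent : ∀ {f E} → f ⊨ E → Consistent E
⊨⇒consistent f⊨E p q = trans (sym (f⊨E p)) (f⊨E q)

⊨-++ : ∀ {f} E {F} → f ⊨ E → f ⊨ F → f ⊨ (E ++ F)
⊨-++ E f⊨E f⊨F p with ∈-++⁻ E p
... | inj₁ p∈E = f⊨E p∈E
... | inj₂ p∈F = f⊨F p∈F

valueOf : List (ℕ × ℕ) → Assignment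
valueOf []             a = nothing
valueOf ((b , δ) ∷ cs) a with b ≟ a
... | yes _ = just δ
... | no  _ = valueOf cs a

valueOf-sound : ∀ cs {a δ} → valueOf cs a ≡ just δ → (a , δ) ∈ cs
valueOf-sound ((b , _) ∷ cs) {a} eq with b ≟ a
valueOf-sound (_ ∷ _)  refl | yes refl = here refl
valueOf-sound (_ ∷ cs) eq   | no  _    = there (valueOf-sound cs eq)

valueOf-complete : ∀ {cs a δ} → Unique (map proj₁ cs) → (a , δ) ∈ cs → valueOf cs a ≡ just δ
valueOf-complete {(b , _) ∷ _} {a} _ (here refl) with b ≟ a
... | yes _  = refl
... | no b≢b = contradiction refl b≢b
valueOf-complete {(b , _) ∷ _} {a} (b∉ ∷ u) (there p) with b ≟ a
... | yes refl = contradiction refl (All.lookup b∉ (∈-map⁺ proj₁ p))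
... | no  _    = valueOf-complete u p

⟦_⟧ : Rule → Assignment
⟦ r ⟧ = valueOf (conds r)

K-holds : ∀ r {f} → (∀ {a δ} → ⟦ r ⟧ a ≡ just δ → f a ≡ just δ) → f ⊨ K r
K-holds r extends p with _ , c∈r , refl ← ∈-map⁻ _ p =
  extends (valueOf-complete (distinct r) c∈r)

⟦⟧⊨⇒K⊆ : ∀ r {r'} → ⟦ r ⟧ ⊨ K r' → K r' ⊆E K r
⟦⟧⊨⇒K⊆ r holds p with _ , _ , refl ← ∈-map⁻ _ p =
  ∈-map⁺ _ (valueOf-sound (conds r) (holds p))

K-unique : ∀ r → Unique (K r)
K-unique r = Unique.map⁺ (λ { refl → refl }) (Unique.map⁻ (distinct r))

≈R⇒K⊆ : ∀ {r r'} → r ≈R r' → K r ⊆E K r'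
≈R⇒K⊆ (conds⇔ , _) p with c , c∈r , refl ← ∈-map⁻ _ p =
  ∈-map⁺ _ (Equivalence.to (conds⇔ c) c∈r)

≈R⇒K⊇ : ∀ {r r'} → r ≈R r' → K r' ⊆E K r
≈R⇒K⊇ (conds⇔ , _) p with c , c∈r' , refl ← ∈-map⁻ _ p =
  ∈-map⁺ _ (Equivalence.from (conds⇔ c) c∈r')

∈R⇒⊆E : ∀ {r τ E} → (∀ {r'} → r' ∈ τ → K r' ⊆E E) → r ∈R τ → K r ⊆E E
∈R⇒⊆E {r} accepted r∈Rτ with r' , r'∈τ , r≈r' ← find r∈Rτ =
  λ p → accepted r'∈τ (≈R⇒K⊆ {r} {r'} r≈r' p)

len≤⇒d≤ : ∀ S {n} → (∀ {r} → r ∈ S → len r ≤ n) → d S ≤ n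
len≤⇒d≤ []      _      = z≤n
len≤⇒d≤ (r ∷ S) len≤n = ⊔-lub (len≤n (here refl)) (len≤⇒d≤ S (len≤n ∘ there))

depth-∈ : ∀ {v t cs} → (v , t) ∈ cs → depth t ≤ depths cs
depth-∈ {cs = (_ , t) ∷ cs} (here refl) = m≤m⊔n (depth t) (depths cs)
depth-∈ {cs = (_ , t) ∷ _}  (there p)   = m≤n⇒m≤o⊔n (depth t) (depth-∈ p)

path-length≤depth : ∀ {Γ E τ h} → Path Γ E τ h → length E ≤ depth Γ
path-length≤depth (leaf _)   = z≤n
path-length≤depth (node m p) = s≤s (≤-trans (path-length≤depth p) (depth-∈ m))

K⊆path⇒len≤depth : ∀ r {Γ E τ h} → Path Γ E τ h → K r ⊆E E → len r ≤ depth Γ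
K⊆path⇒len≤depth r {Γ} {E} p K⊆E = begin
  len r          ≡⟨ sym (length-map _ (conds r)) ⟩
  length (K r)   ≤⟨ unique⊆⇒length≤ (K-unique r) K⊆E ⟩
  length E       ≤⟨ path-length≤depth p ⟩
  depth Γ        ∎
  where open ≤-Reasoning

¬¬K⊆path⇒len≤depth : ∀ r {Γ E τ h} → Path Γ E τ h → ¬ ¬ (K r ⊆E E) → len r ≤ depth Γ
¬¬K⊆path⇒len≤depth r {Γ} p ¬¬K⊆E = decidable-stable (len r ≤? depth Γ) λ too-long →
  ¬¬K⊆E λ K⊆E → too-long (K⊆path⇒len≤depth r p K⊆E)

record PathAlong (S : List Rule) (f : Assignment) (Γ : Tree) : Set where
  field
    {eqs}   : List Eq
    {rules} : List Rule
    {size}  : ℕ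
    path    : Path Γ eqs rules size
    holds   : f ⊨ eqs
    rules∈S : ∀ {r} → r ∈ rules → r ∈R S

module _ {S : List Rule} {L : ℕ → Maybe ℕ → Set} {f : Assignment}
         (admissible : ∀ a → InA S a → L a (f a)) where

  mutual
    followPath : ∀ {Γ} → WF S L Γ → PathAlong S f Γ
    followPath (leaf τ τ∈S) = record { path = leaf τ ; holds = λ () ; rules∈S = τ∈S }
    followPath (node a cs a∈A _ labels subtrees)
      with _ , edge , ξ ← followEdge cs subtrees (Equivalence.from (labels (f a)) (admissible a a∈A)) =
      record { path = node edge path ; holds = λ { (here refl) → refl ; (there q) → holds q }
             ; rules∈S = rules∈S }
      where open PathAlong ξ

    followEdge : ∀ {v} cs → All (λ c → WF S L (proj₂ c)) cs → v ∈ map proj₁ cs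
               → ∃ λ t → (v , t) ∈ cs × PathAlong S f t
    followEdge ((_ , t) ∷ _)  (wf ∷ _)   (here refl) = t , here refl , followPath wf
    followEdge (_ ∷ cs)       (_ ∷ wfs)  (there v∈) with t , edge , ξ ← followEdge cs wfs v∈ =
      t , there edge , ξ

valueOf-label : ∀ {S r a δ} → r ∈ S → ⟦ r ⟧ a ≡ just δ → OLabel S a (just δ)
valueOf-label {r = r} r∈S eq = _ , refl , r , r∈S , valueOf-sound (conds r) eq

someValue : List Rule → Assignment
someValue []      a = nothing
someValue (r ∷ S) a = ⟦ r ⟧ a <∣> someValue S a

someValue-label : ∀ S {a} → InA S a → OLabel S a (someValue S a)
someValue-label (r ∷ S) {a} a∈A with ⟦ r ⟧ a in eq | a∈A
... | just _  | _ = valueOf-label (here refl) eq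
... | nothing | δ , _ , here refl , c∈r
  with () ← trans (sym eq) (valueOf-complete (distinct r) c∈r)
... | nothing | δ , r' , there r'∈S , c∈r'
  with δ' , e , r'' , r''∈S , c∈r'' ← someValue-label S (δ , r' , r'∈S , c∈r') =
  δ' , e , r'' , there r''∈S , c∈r''

-- In an o-tree there is no * edge, so r is completed by arbitrary values from V_S.
oCompletion : Rule → List Rule → Assignment
oCompletion r S a = ⟦ r ⟧ a <∣> someValue S a

oCompletion-label : ∀ {S r} → r ∈ S → ∀ a → InA S a → OLabel S a (oCompletion r S a)
oCompletion-label {S} {r} r∈S a a∈A with ⟦ r ⟧ a in eq
... | just _  = valueOf-label r∈S eq
... | nothing = someValue-label S a∈A

⟦⟧-label : ∀ {S r} → r ∈ S → ∀ a → InA S a → ELabel S a (⟦ r ⟧ a)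
⟦⟧-label {r = r} r∈S a _ with ⟦ r ⟧ a in eq
... | just _  = inj₂ (valueOf-label r∈S eq)
... | nothing = inj₁ refl

ar-len≤depth : ∀ {S Γ} → OTree S Γ → SolvesAR S Γ → ∀ {r} → r ∈ S → len r ≤ depth Γ
ar-len≤depth {S} wf solves {r} r∈S = ¬¬K⊆path⇒len≤depth r path λ not-covered →
  proj₂ (solves path consistent) r∈S
    (λ r∈Rτ → not-covered (∈R⇒⊆E {r} (proj₁ (solves path consistent)) r∈Rτ))
    consistent-with-r
  where
  open PathAlong (followPath (oCompletion-label r∈S) wf)
  consistent : Consistent eqs
  consistent = ⊨⇒consistent holds
  consistent-with-r : Consistent (K r ++ eqs)
  consistent-with-r = ⊨⇒consistent (⊨-++ (K r) (K-holds r λ {a} → cong (_<∣> someValue S a)) holds)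

module Along {S Γ} (r : Rule) (r∈S : r ∈ S) (wf : ETree S Γ) where

  open PathAlong (followPath (⟦⟧-label r∈S) wf) public

  consistent : Consistent eqs
  consistent = ⊨⇒consistent holds

  consistent-with-r : Consistent (K r ++ eqs)
  consistent-with-r = ⊨⇒consistent (⊨-++ (K r) (K-holds r (λ e → e)) holds)

  -- An accepted rule lies in r because ⟦ r ⟧ is * off A(r); reducedness then forces it to contain r.
  covered-unless-strictly-below : ∀ {r'} → r' ∈ rules → K r' ⊆E eqs
    → (∀ {r''} → r'' ∈ S → rhs r' ≡ rhs r'' → ¬ (r'' ⊂K r)) → ¬ ¬ (K r ⊆E eqs)
  covered-unless-strictly-below {r'} r'∈τ K'⊆eqs not-below not-covered
    with r'' , r''∈S , r'≈r'' ← find (rules∈S r'∈τ) =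
    not-below r''∈S (proj₂ r'≈r'')
      (⟦⟧⊨⇒K⊆ r {r''} (λ p → holds (K''⊆eqs p)) , λ K⊆K'' → not-covered (λ p → K''⊆eqs (K⊆K'' p)))
    where
    K''⊆eqs : K r'' ⊆E eqs
    K''⊆eqs p = K'⊆eqs (≈R⇒K⊇ {r'} {r''} r'≈r'' p)

sr-len≤depth : ∀ {S Γ} → SRReduced S → ETree S Γ → SolvesSR S Γ → ∀ {r} → r ∈ S → len r ≤ depth Γ
sr-len≤depth reduced wf solves {r} r∈S = ¬¬K⊆path⇒len≤depth r path covered-or-empty
  where
  open Along r r∈S wf
  covered-or-empty : ¬ ¬ (K r ⊆E eqs)
  covered-or-empty not-covered with rules in τ≡
  ... | []     = proj₂ (solves path consistent) τ≡ r∈S consistent-with-r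
  ... | r' ∷ _ =
    covered-unless-strictly-below r'∈τ (proj₁ (solves path consistent) r'∈τ)
      (λ r''∈S _ → reduced r∈S r''∈S) not-covered
    where
    r'∈τ : r' ∈ rules
    r'∈τ = subst (r' ∈_) (sym τ≡) (here refl)

ad-len≤depth : ∀ {S Γ} → ADReduced S → ETree S Γ → SolvesAD S Γ → ∀ {r} → r ∈ S → len r ≤ depth Γ
ad-len≤depth reduced wf solves {r} r∈S = ¬¬K⊆path⇒len≤depth r path λ not-covered →
  proj₂ (solves path consistent) r∈S
    (λ r∈Rτ → not-covered (∈R⇒⊆E {r} accepted r∈Rτ))
    (λ rhs∈D → covered-via-same-rhs rhs∈D not-covered)
    consistent-with-r
  where
  open Along r r∈S wf
  accepted : ∀ {r'} → r' ∈ rules → K r' ⊆E eqs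
  accepted = proj₁ (solves path consistent)
  covered-via-same-rhs : rhs r ∈ D rules → ¬ ¬ (K r ⊆E eqs)
  covered-via-same-rhs rhs∈D with r' , r'∈τ , rhs≡ ← ∈-map⁻ rhs rhs∈D =
    covered-unless-strictly-below r'∈τ (accepted r'∈τ) (λ r''∈S e → reduced r∈S r''∈S (trans rhs≡ e))

mutual
  strip : Tree → Tree
  strip (leaf τ)    = leaf τ
  strip (node a cs) = node a (stripEdges cs)

  stripEdges : List (Maybe ℕ × Tree) → List (Maybe ℕ × Tree)
  stripEdges []                   = []
  stripEdges ((nothing , _) ∷ cs) = stripEdges cs
  stripEdges ((just δ , t) ∷ cs)  = (just δ , strip t) ∷ stripEdges cs

∈-stripEdges⁻ : ∀ cs {v t'} → (v , t') ∈ stripEdges cs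
              → ∃ λ t → (v , t) ∈ cs × t' ≡ strip t × v ≢ nothing
∈-stripEdges⁻ ((nothing , _) ∷ cs) p with t , e∈ , eq , v≢* ← ∈-stripEdges⁻ cs p =
  t , there e∈ , eq , v≢*
∈-stripEdges⁻ ((just _ , t) ∷ _)  (here refl) = t , here refl , refl , λ ()
∈-stripEdges⁻ ((just _ , _) ∷ cs) (there p) with t , e∈ , eq , v≢* ← ∈-stripEdges⁻ cs p =
  t , there e∈ , eq , v≢*

∈-stripEdges⁺ : ∀ cs {δ t} → (just δ , t) ∈ cs → (just δ , strip t) ∈ stripEdges cs
∈-stripEdges⁺ ((nothing , _) ∷ cs) (there p)   = ∈-stripEdges⁺ cs p
∈-stripEdges⁺ ((just _ , _) ∷ _)   (here refl) = here refl
∈-stripEdges⁺ ((just _ , _) ∷ cs)  (there p)   = there (∈-stripEdges⁺ cs p)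

stripEdges-label⁻ : ∀ cs {v} → v ∈ map proj₁ (stripEdges cs) → v ∈ map proj₁ cs × v ≢ nothing
stripEdges-label⁻ cs p
  with _ , e∈ , refl ← ∈-map⁻ proj₁ p
  with _ , e∈cs , _ , v≢* ← ∈-stripEdges⁻ cs e∈ =
  ∈-map⁺ proj₁ e∈cs , v≢*

stripEdges-label⁺ : ∀ cs {δ} → just δ ∈ map proj₁ cs → just δ ∈ map proj₁ (stripEdges cs)
stripEdges-label⁺ cs p with _ , e∈ , refl ← ∈-map⁻ proj₁ p = ∈-map⁺ proj₁ (∈-stripEdges⁺ cs e∈)

stripEdges-unique : ∀ cs → Unique (map proj₁ cs) → Unique (map proj₁ (stripEdges cs))
stripEdges-unique []                   _         = []
stripEdges-unique ((nothing , _) ∷ cs) (_ ∷ u)   = stripEdges-unique cs u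
stripEdges-unique ((just _ , _) ∷ cs)  (δ∉ ∷ u) =
  All.tabulate (λ p → All.lookup δ∉ (proj₁ (stripEdges-label⁻ cs p))) ∷ stripEdges-unique cs u

mutual
  strip-OTree : ∀ {S Γ} → ETree S Γ → OTree S (strip Γ)
  strip-OTree (leaf τ τ∈S) = leaf τ τ∈S
  strip-OTree {S} (node a cs a∈A unique labels subtrees) =
    node a (stripEdges cs) a∈A (stripEdges-unique cs unique)
      (λ v → mk⇔ (to v) (from v)) (stripEdges-OTree cs subtrees)
    where
    to : ∀ v → v ∈ map proj₁ (stripEdges cs) → OLabel S a v
    to v p with v∈ , v≢* ← stripEdges-label⁻ cs p with Equivalence.to (labels v) v∈
    ... | inj₁ v≡* = contradiction v≡* v≢*
    ... | inj₂ ok  = ok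
    from : ∀ v → OLabel S a v → v ∈ map proj₁ (stripEdges cs)
    from v ok@(_ , refl , _) = stripEdges-label⁺ cs (Equivalence.from (labels v) (inj₂ ok))

  stripEdges-OTree : ∀ {S} cs → All (λ c → ETree S (proj₂ c)) cs
                   → All (λ c → OTree S (proj₂ c)) (stripEdges cs)
  stripEdges-OTree []                   []         = []
  stripEdges-OTree ((nothing , _) ∷ cs) (_ ∷ wfs)  = stripEdges-OTree cs wfs
  stripEdges-OTree ((just _ , _) ∷ cs)  (wf ∷ wfs) = strip-OTree wf ∷ stripEdges-OTree cs wfs

mutual
  strip-depth : ∀ Γ → depth (strip Γ) ≤ depth Γ
  strip-depth (leaf _)    = z≤n
  strip-depth (node _ cs) = s≤s (stripEdges-depths cs)

  stripEdges-depths : ∀ cs → depths (stripEdges cs) ≤ depths cs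
  stripEdges-depths []                   = z≤n
  stripEdges-depths ((nothing , t) ∷ cs) = m≤n⇒m≤o⊔n (depth t) (stripEdges-depths cs)
  stripEdges-depths ((just _ , t) ∷ cs)  = ⊔-mono-≤ (strip-depth t) (stripEdges-depths cs)

strip-path : ∀ Γ {E τ h} → Path (strip Γ) E τ h → Path Γ E τ h
strip-path (leaf τ)    (leaf _)      = leaf τ
strip-path (node _ cs) (node e∈ p) with t , e∈cs , refl , _ ← ∈-stripEdges⁻ cs e∈ =
  node e∈cs (strip-path t p)

strip-SolvesAR : ∀ {S} Γ → SolvesAR S Γ → SolvesAR S (strip Γ)
strip-SolvesAR Γ solves p = solves (strip-path Γ p)

lemma8 : (S : List Rule) → S ≢ []
         → (((Γ : Tree) → ETree S Γ → SolvesAR S Γ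
               → Σ Tree (λ Γ' → OTree S Γ' × SolvesAR S Γ' × depth Γ' ≤ depth Γ))
            × ((Γ : Tree) → OTree S Γ → SolvesAR S Γ → d S ≤ depth Γ))
         × (SRReduced S → (Γ : Tree) → ETree S Γ → SolvesSR S Γ → d S ≤ depth Γ)
         × (ADReduced S → (Γ : Tree) → ETree S Γ → SolvesAD S Γ → d S ≤ depth Γ)
lemma8 S _ =
  ( ( λ Γ wf solves → strip Γ , strip-OTree wf , strip-SolvesAR Γ solves , strip-depth Γ)
  , λ Γ wf solves → len≤⇒d≤ S (ar-len≤depth wf solves))
  , (λ reduced Γ wf solves → len≤⇒d≤ S (sr-len≤depth reduced wf solves))
  , (λ reduced Γ wf solves → len≤⇒d≤ S (ad-len≤depth reduced wf solves))
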